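{- Let $d \geq 3$ and let $f:\mathbb{P}^1 \to \mathbb{P}^1$ be a degree-$d$ single-cycle Belyi map with combinatorial type $(e_0, e_1, e_\infty)$. Then $f$ admits (i.e. its isomorphism class corresponds to) a planar dessin d'enfant consisting of: \begin{itemize} \item $d - e_1$ white vertices of degree one, each connected to a single black vertex of degree $e_0$; \item $d - e_0$ black vertices of degree one, each connected to a single white vertex of degree $e_1$; and \item $e_0 + e_1 - d$ edges connecting the black vertex of degree $e_0$ and the white vertex of degree $e_1$. \end{itemize}
   Context: A Belyi map is a finite morphism $f: X \to \mathbb{P}^1$ from a smooth projective curve $X$ that is ramified only over $0, 1, \infty$; its genus is the genus of $X$. A Belyi map is a single-cycle Belyi map if it has exactly one ramification point above each of the three branch points $0,1,\infty$ (so it has exactly three critical points; in particular $d\ge 3$). For a genus-$0$ single-cycle Belyi map, its combinatorial type (generating system) $(e_0,e_1,e_\infty)$ records the ramification index $e_i$ of the unique critical point above $i\in\{0,1,\infty\}$; equivalently, the monodromy permutations $\sigma_0,\sigma_1,\sigma_\infty\in S_d$ (with $\sigma_0\sigma_1\sigma_\infty=1$ and $\langle\sigma_0,\sigma_1\rangle$ transitive) each consist of a single nontrivial cycle, of length $e_0,e_1,e_\infty$ respectively. A dessin d'enfant is a connected bipartite graph (black and white vertices) embedded in an orientable surface, with a cyclic ordering of the edges at each vertex. The dessin of $f$ has a black vertex for each point of $f^{ -1}(0)$, a white vertex for each point of $f^{ -1}(1)$, and an edge for each component of $f^{ -1}((0,1))$; equivalently, from a generating system, black vertices correspond to cycles of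 $\sigma_0$ (including 1-cycles), white vertices to cycles of $\sigma_1$ (including 1-cycles), edges to $\{1,\dots,d\}$, with cyclic orderings given by the cycles. By Riemann's Existence Theorem, isomorphism classes of degree-$d$ Belyi maps correspond bijectively to isomorphism classes of dessins with $d$ edges. -}

module Defs where

open import Data.Nat using (ℕ; zero; suc; _+_; _≤_; _<_)
open import Data.Fin using (Fin; toℕ)
open import Data.Fin.Properties using (_≟_)
open import Data.Fin.Permutation using (Permutation′; _⟨$⟩ʳ_; _∘ₚ_; flip)
open import Data.List using (List; length; filter; allFin)
open import Data.Product using (Σ; ∃; _×_; _,_)
open import Relation.Nullary using (¬_; Dec)
open import Relation.Unary using (Pred; Decidable)
open import Relation.Binary.PropositionalEquality using (_≡_; _≢_)
open import Relation.Nullary using (¬?)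

iter : ∀ {d} → Permutation′ d → ℕ → Fin d → Fin d
iter σ zero x = x
iter σ (suc k) x = σ ⟨$⟩ʳ (iter σ k x)

count : ∀ {d} (P : Pred (Fin d) Agda.Primitive.lzero) → Decidable P → ℕ
count {d} P P? = length (filter P? (allFin d))

Moved : ∀ {d} → Permutation′ d → Fin d → Set
Moved σ x = σ ⟨$⟩ʳ x ≢ x

Moved? : ∀ {d} (σ : Permutation′ d) → Decidable (Moved σ)
Moved? σ x = ¬? ((σ ⟨$⟩ʳ x) ≟ x)

Fixed : ∀ {d} → Permutation′ d → Fin d → Set
Fixed σ x = σ ⟨$⟩ʳ x ≡ x

Fixed? : ∀ {d} (σ : Permutation′ d) → Decidable (Fixed σ)
Fixed? σ x = (σ ⟨$⟩ʳ x) ≟ x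

SingleCycle : ∀ {d} → Permutation′ d → ℕ → Set
SingleCycle {d} σ e =
  2 ≤ e ×
  Σ (Fin d) λ x₀ →
    (∀ i j → i < e → j < e → iter σ i x₀ ≡ iter σ j x₀ → i ≡ j) ×
    iter σ e x₀ ≡ x₀ ×
    (∀ x → (∀ i → i < e → iter σ i x₀ ≢ x) → σ ⟨$⟩ʳ x ≡ x)

-- number of cycles (including 1-cycles) of σ: the number of points that are
-- the smallest element of their σ-orbit
IsOrbitMin : ∀ {d} → Permutation′ d → Fin d → Set
IsOrbitMin {d} σ x = ∀ k → k < d → toℕ x ≤ toℕ (iter σ k x)

open import Data.Nat.Properties using (_≤?_)
open import Relation.Nullary using (yes; no)
open import Data.Nat.Properties using (n<1+n)

private
  allBelow? : (n : ℕ) (P : ℕ → Set) → (∀ k → Dec (P k)) → Dec (∀ k → k < n → P k)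
  allBelow? zero P P? = yes λ k ()
  allBelow? (suc n) P P? with allBelow? n P P? | P? n
  ... | no ¬p | _ = no λ h → ¬p (λ k k<n → h k (Data.Nat.Properties.m<n⇒m<1+n k<n))
  ... | yes _ | no ¬q = no λ h → ¬q (h n (n<1+n n))
  ... | yes p | yes q = yes λ k k<1+n → go k (Data.Nat.Properties.m≤n⇒m<n∨m≡n (Data.Nat.Properties.≤-pred k<1+n))
    where
      open import Data.Sum using (inj₁; inj₂)
      go : ∀ k → _ → P k
      go k (inj₁ k<n) = p k k<n
      go k (inj₂ Relation.Binary.PropositionalEquality.refl) = q

IsOrbitMin? : ∀ {d} (σ : Permutation′ d) → Decidable (IsOrbitMin σ)
IsOrbitMin? {d} σ x = allBelow? d _ (λ k → toℕ x ≤? toℕ (iter σ k x))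

cycleCount : ∀ {d} → Permutation′ d → ℕ
cycleCount σ = count (IsOrbitMin σ) (IsOrbitMin? σ)

-- y is reachable from x under the monoid generated by σ₀, σ₁
-- (in a finite group this is the subgroup ⟨σ₀,σ₁⟩)
data Reach {d} (σ₀ σ₁ : Permutation′ d) (x : Fin d) : Fin d → Set where
  here : Reach σ₀ σ₁ x x
  step₀ : ∀ {y} → Reach σ₀ σ₁ x y → Reach σ₀ σ₁ x (σ₀ ⟨$⟩ʳ y)
  step₁ : ∀ {y} → Reach σ₀ σ₁ x y → Reach σ₀ σ₁ x (σ₁ ⟨$⟩ʳ y)

Transitive : ∀ {d} → Permutation′ d → Permutation′ d → Set
Transitive {d} σ₀ σ₁ = ∀ x y → Reach σ₀ σ₁ x y

-- σ∞ determined by σ₀ σ₁ σ∞ = 1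
σ∞ : ∀ {d} → Permutation′ d → Permutation′ d → Permutation′ d
σ∞ σ₀ σ₁ = flip (σ₀ ∘ₚ σ₁)

-- genus of the dessin via Euler's formula: V - E + F = 2 - 2g, with
-- V = #cycles σ₀ + #cycles σ₁, E = d, F = #cycles σ∞.  Genus 0 (planar):
Genus0 : ∀ {d} → Permutation′ d → Permutation′ d → Set
Genus0 {d} σ₀ σ₁ = cycleCount σ₀ + cycleCount σ₁ + cycleCount (σ∞ σ₀ σ₁) ≡ d + 2

SingleCycleGenus0System : (d e₀ e₁ e∞ : ℕ) → Permutation′ d → Permutation′ d → Set
SingleCycleGenus0System d e₀ e₁ e∞ σ₀ σ₁ =
  Transitive σ₀ σ₁ × SingleCycle σ₀ e₀ × SingleCycle σ₁ e₁ ×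
  SingleCycle (σ∞ σ₀ σ₁) e∞ × Genus0 σ₀ σ₁

module Submission where

-- Write M₀, M₁ for the sets of points moved by σ₀, σ₁.
--  (1) A single cycle of length e moves exactly e points: its support is
--      the orbit x₀, σx₀, …, σ^{e-1}x₀, whose points are pairwise distinct;
--      hence it fixes d ∸ e points.
--  (2) Transitivity forbids a common fixed point of σ₀ and σ₁ (when d ≥ 2):
--      such a point would be reachable only from itself.  So M₀ ∪ M₁ is
--      everything, and a point fixed by one generator is moved by the other.
--  (3) Inclusion–exclusion for M₀, M₁ then gives |M₀ ∩ M₁| + d = e₀ + e₁,
--      which yields d ≤ e₀ + e₁ and |M₀ ∩ M₁| = e₀ + e₁ ∸ d.
-- These counts are exactly the three kinds of edges of the dessin.

open import Defs
open import Data.Nat using (ℕ; _+_; _∸_; _≤_)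
open import Data.Fin.Permutation using (Permutation′; _⟨$⟩ʳ_)
open import Data.Product using (_×_)
open import Relation.Binary.PropositionalEquality using (_≡_; _≢_)
open import Relation.Nullary using (_×-dec_)

open import Agda.Primitive using (lzero)
open import Data.Empty using (⊥)
open import Data.Nat using (zero; suc; _<_; s≤s; z≤n)
open import Data.Nat.Properties
  using (+-suc; +-comm; +-identityʳ; m+n∸n≡m; m≤n+m; ≤-trans; n≤1+n; 1+n≢n; <-irrefl; n<1+n; m<n⇒m<1+n; m≤n⇒m<n∨m≡n)
open import Data.Fin using (Fin; punchIn) renaming (zero to fzero)
open import Data.Fin.Properties using (_≟_; punchInᵢ≢i)
open import Data.List using (List; _∷_; []; length; filter; allFin)
open import Data.List.Properties using (filter-all; filter-none; filter-accept; filter-reject; filter-≐; length-tabulate)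
import Data.List.Relation.Unary.All as All
open import Data.List.Relation.Unary.Any using (here; there)
open import Data.List.Relation.Unary.AllPairs using (_∷_)
open import Data.List.Relation.Unary.Unique.Propositional using (Unique)
open import Data.List.Relation.Unary.Unique.Propositional.Properties using (allFin⁺)
open import Data.List.Membership.Propositional using (_∈_)
open import Data.List.Membership.Propositional.Properties using (∈-allFin)
open import Data.Product using (∃-syntax; _,_)
open import Data.Sum using (_⊎_; inj₁; inj₂)
open import Function using (id)
open import Relation.Binary.Definitions using (DecidableEquality)
open import Relation.Binary.PropositionalEquality using (refl; sym; trans; cong; cong₂; subst; module ≡-Reasoning)
open import Relation.Nullary using (¬_; yes; no)
open import Relation.Nullary.Decidable using (decidable-stable)
open import Relation.Unary using (Pred; Decidable; ∅; _∪_; _≐_)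
open import Relation.Unary.Properties using (∅?; ∁?; _∪?_; _∩?_)

open ≡-Reasoning

countIn : {A : Set} {P : Pred A lzero} → Decidable P → List A → ℕ
countIn P? xs = length (filter P? xs)

module _ {A : Set} {P Q : Pred A lzero} (P? : Decidable P) (Q? : Decidable Q) where

  inclusion-exclusion : (xs : List A) →
    countIn (P? ∪? Q?) xs + countIn (P? ∩? Q?) xs ≡ countIn P? xs + countIn Q? xs
  inclusion-exclusion [] = refl
  inclusion-exclusion (x ∷ xs) with P? x | Q? x | inclusion-exclusion xs
  ... | yes _ | yes _ | ih = cong suc (trans (+-suc _ _) (trans (cong suc ih) (sym (+-suc _ _))))
  ... | yes _ | no _  | ih = cong suc ih
  ... | no _  | yes _ | ih = trans (cong suc ih) (sym (+-suc _ _))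
  ... | no _  | no _  | ih = ih

  count-disjoint-union : (∀ x → P x → Q x → ⊥) → (xs : List A) →
    countIn (P? ∪? Q?) xs ≡ countIn P? xs + countIn Q? xs
  count-disjoint-union disjoint xs = begin
    countIn (P? ∪? Q?) xs                          ≡⟨ sym (+-identityʳ _) ⟩
    countIn (P? ∪? Q?) xs + 0                      ≡⟨ cong (countIn (P? ∪? Q?) xs +_) (sym noBoth) ⟩
    countIn (P? ∪? Q?) xs + countIn (P? ∩? Q?) xs  ≡⟨ inclusion-exclusion xs ⟩
    countIn P? xs + countIn Q? xs                  ∎
    where
    noBoth : countIn (P? ∩? Q?) xs ≡ 0
    noBoth = cong length (filter-none (P? ∩? Q?) (All.universal (λ x (p , q) → disjoint x p q) xs))

  count-covering : (∀ x → P x ⊎ Q x) → (xs : List A) →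
    countIn (P? ∩? Q?) xs + length xs ≡ countIn P? xs + countIn Q? xs
  count-covering cover xs = begin
    countIn (P? ∩? Q?) xs + length xs              ≡⟨ +-comm _ (length xs) ⟩
    length xs + countIn (P? ∩? Q?) xs              ≡⟨ cong (λ n → length n + countIn (P? ∩? Q?) xs) (sym everyone) ⟩
    countIn (P? ∪? Q?) xs + countIn (P? ∩? Q?) xs  ≡⟨ inclusion-exclusion xs ⟩
    countIn P? xs + countIn Q? xs                  ∎
    where
    everyone : filter (P? ∪? Q?) xs ≡ xs
    everyone = filter-all (P? ∪? Q?) (All.universal cover xs)

count-complement : {A : Set} {P : Pred A lzero} (P? : Decidable P) (xs : List A) →
  countIn P? xs + countIn (∁? P?) xs ≡ length xs
count-complement {P = P} P? xs = begin
  countIn P? xs + countIn (∁? P?) xs  ≡⟨ sym (count-disjoint-union P? (∁? P?) (λ x p ¬p → ¬p p) xs) ⟩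
  countIn (P? ∪? ∁? P?) xs            ≡⟨ cong length (filter-all (P? ∪? ∁? P?) (All.universal excludedMiddle xs)) ⟩
  length xs                           ∎
  where
  excludedMiddle : ∀ x → P x ⊎ ¬ P x
  excludedMiddle x with P? x
  ... | yes p = inj₁ p
  ... | no ¬p = inj₂ ¬p

module _ {A : Set} (_≟ᴬ_ : DecidableEquality A) where

  count-member : {xs : List A} {a : A} → Unique xs → a ∈ xs → countIn (a ≟ᴬ_) xs ≡ 1
  count-member {a = a} (a∉xs ∷ _) (here refl) =
    cong length (trans (filter-accept (a ≟ᴬ_) refl) (cong (a ∷_) (filter-none (a ≟ᴬ_) a∉xs)))
  count-member {a = a} (x∉xs ∷ unique) (there a∈xs) =
    trans (cong length (filter-reject (a ≟ᴬ_) (λ a≡x → All.lookup x∉xs a∈xs (sym a≡x))))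
          (count-member unique a∈xs)

  module FirstTerms (f : ℕ → A) where

    FirstTerms : ℕ → Pred A lzero
    FirstTerms zero    = ∅
    FirstTerms (suc k) = (f k ≡_) ∪ FirstTerms k

    firstTerms? : ∀ k → Decidable (FirstTerms k)
    firstTerms? zero    = ∅?
    firstTerms? (suc k) = (f k ≟ᴬ_) ∪? firstTerms? k

    firstTerms⁺ : ∀ {k i x} → i < k → f i ≡ x → FirstTerms k x
    firstTerms⁺ {suc k} (s≤s i≤k) fi≡x with m≤n⇒m<n∨m≡n i≤k
    ... | inj₁ i<k  = inj₂ (firstTerms⁺ i<k fi≡x)
    ... | inj₂ refl = inj₁ fi≡x

    firstTerms⁻ : ∀ {k x} → FirstTerms k x → ∃[ i ] (i < k × f i ≡ x)
    firstTerms⁻ {suc k} (inj₁ fk≡x) = k , n<1+n k , fk≡x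
    firstTerms⁻ {suc k} (inj₂ earlier) with firstTerms⁻ earlier
    ... | i , i<k , fi≡x = i , m<n⇒m<1+n i<k , fi≡x

    InjectiveBelow : ℕ → Set
    InjectiveBelow k = ∀ i j → i < k → j < k → f i ≡ f j → i ≡ j

    count-firstTerms : {xs : List A} → Unique xs → (∀ a → a ∈ xs) →
      ∀ k → InjectiveBelow k → countIn (firstTerms? k) xs ≡ k
    count-firstTerms {xs} unique complete zero _ =
      cong length (filter-none ∅? (All.universal (λ _ ()) xs))
    count-firstTerms {xs} unique complete (suc k) injective = begin
      countIn (firstTerms? (suc k)) xs                    ≡⟨ count-disjoint-union (f k ≟ᴬ_) (firstTerms? k) new xs ⟩
      countIn (f k ≟ᴬ_) xs + countIn (firstTerms? k) xs  ≡⟨ cong₂ _+_ (count-member unique (complete (f k)))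
                                                                       (count-firstTerms unique complete k injectiveBelow-k) ⟩
      suc k                                               ∎
      where
      injectiveBelow-k : InjectiveBelow k
      injectiveBelow-k i j i<k j<k = injective i j (m<n⇒m<1+n i<k) (m<n⇒m<1+n j<k)

      new : ∀ x → f k ≡ x → FirstTerms k x → ⊥
      new x refl earlier with firstTerms⁻ earlier
      ... | i , i<k , fi≡fk = <-irrefl (injective i k (m<n⇒m<1+n i<k) (n<1+n k) fi≡fk) i<k

module Orbit {d : ℕ} (σ : Permutation′ d) (x₀ : Fin d) where

  orbit : ℕ → Fin d
  orbit i = iter σ i x₀

  open FirstTerms _≟_ orbit public

  cycle-has-no-fixed-point : ∀ {e} → 2 ≤ e → InjectiveBelow e → orbit e ≡ x₀ →
    ∀ {i} → i < e → orbit (suc i) ≢ orbit i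
  cycle-has-no-fixed-point 2≤e injective closes {i} i<e fixed with m≤n⇒m<n∨m≡n i<e
  ... | inj₁ 1+i<e = 1+n≢n (injective (suc i) i 1+i<e i<e fixed)
  ... | inj₂ refl with injective 0 i (s≤s z≤n) i<e (trans (sym closes) fixed) | 2≤e
  ...   | refl | s≤s ()

  inCycle⇒moved : ∀ {e} → 2 ≤ e → InjectiveBelow e → orbit e ≡ x₀ →
    ∀ {x} → FirstTerms e x → Moved σ x
  inCycle⇒moved {e} 2≤e injective closes {x} onCycle with firstTerms⁻ {e} {x} onCycle
  ... | i , i<e , refl = cycle-has-no-fixed-point 2≤e injective closes i<e

  moved⇒inCycle : ∀ {e} → (∀ x → (∀ i → i < e → orbit i ≢ x) → Fixed σ x) →
    ∀ {x} → Moved σ x → FirstTerms e x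
  moved⇒inCycle {e} fixesRest {x} moved =
    decidable-stable (firstTerms? e x)
      (λ offCycle → moved (fixesRest x (λ i i<e onCycle → offCycle (firstTerms⁺ i<e onCycle))))

singleCycle-moved : ∀ {d e} {σ : Permutation′ d} → SingleCycle σ e → count (Moved σ) (Moved? σ) ≡ e
singleCycle-moved {d} {e} {σ} (2≤e , x₀ , injective , closes , fixesRest) = begin
  count (Moved σ) (Moved? σ)          ≡⟨ cong length (filter-≐ (Moved? σ) (firstTerms? e) support (allFin d)) ⟩
  countIn (firstTerms? e) (allFin d)  ≡⟨ count-firstTerms (allFin⁺ d) ∈-allFin e injective ⟩
  e                                   ∎
  where
  open Orbit σ x₀
  support : Moved σ ≐ FirstTerms e
  support = moved⇒inCycle fixesRest , inCycle⇒moved 2≤e injective closes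

singleCycle-fixed : ∀ {d e} {σ : Permutation′ d} → SingleCycle σ e → count (Fixed σ) (Fixed? σ) ≡ d ∸ e
singleCycle-fixed {d} {e} {σ} cycle = begin
  fixed                 ≡⟨ sym (m+n∸n≡m fixed e) ⟩
  fixed + e ∸ e         ≡⟨ cong (λ n → fixed + n ∸ e) (sym (singleCycle-moved cycle)) ⟩
  fixed + moved ∸ e     ≡⟨ cong (_∸ e) (count-complement (Fixed? σ) (allFin d)) ⟩
  length (allFin d) ∸ e ≡⟨ cong (_∸ e) (length-tabulate id) ⟩
  d ∸ e                 ∎
  where
  fixed moved : ℕ
  fixed = count (Fixed σ) (Fixed? σ)
  moved = count (Moved σ) (Moved? σ)

reach-from-common-fixed : ∀ {d} {σ₀ σ₁ : Permutation′ d} {x y} →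
  Fixed σ₀ x → Fixed σ₁ x → Reach σ₀ σ₁ x y → y ≡ x
reach-from-common-fixed fixed₀ fixed₁ here = refl
reach-from-common-fixed fixed₀ fixed₁ (step₀ r) with reach-from-common-fixed fixed₀ fixed₁ r
... | refl = fixed₀
reach-from-common-fixed fixed₀ fixed₁ (step₁ r) with reach-from-common-fixed fixed₀ fixed₁ r
... | refl = fixed₁

no-common-fixed-point : ∀ {d} {σ₀ σ₁ : Permutation′ d} → 2 ≤ d → Transitive σ₀ σ₁ →
  ∀ x → Fixed σ₀ x → Fixed σ₁ x → ⊥
no-common-fixed-point {suc (suc _)} (s≤s (s≤s z≤n)) transitive x fixed₀ fixed₁ =
  punchInᵢ≢i x fzero (reach-from-common-fixed fixed₀ fixed₁ (transitive x (punchIn x fzero)))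

theorem2p1 : (d e₀ e₁ e∞ : ℕ) → 3 ≤ d → (σ₀ σ₁ : Permutation′ d) →
    SingleCycleGenus0System d e₀ e₁ e∞ σ₀ σ₁ →
      d ≤ e₀ + e₁ ×
      count (Fixed σ₁) (Fixed? σ₁) ≡ d ∸ e₁ ×
      (∀ x → Fixed σ₁ x → Moved σ₀ x) ×
      count (Fixed σ₀) (Fixed? σ₀) ≡ d ∸ e₀ ×
      (∀ x → Fixed σ₀ x → Moved σ₁ x) ×
      count (λ x → Moved σ₀ x × Moved σ₁ x) (λ x → Moved? σ₀ x ×-dec Moved? σ₁ x) ≡ e₀ + e₁ ∸ d
theorem2p1 d e₀ e₁ e∞ 3≤d σ₀ σ₁ (transitive , cycle₀ , cycle₁ , _ , _) =
  subst (d ≤_) both+d≡e₀+e₁ (m≤n+m d both) ,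
  singleCycle-fixed cycle₁ , (λ x fixed₁ fixed₀ → noCommon x fixed₀ fixed₁) ,
  singleCycle-fixed cycle₀ , (λ x fixed₀ fixed₁ → noCommon x fixed₀ fixed₁) ,
  trans (sym (m+n∸n≡m both d)) (cong (_∸ d) both+d≡e₀+e₁)
  where
  noCommon : ∀ x → Fixed σ₀ x → Fixed σ₁ x → ⊥
  noCommon = no-common-fixed-point (≤-trans (n≤1+n 2) 3≤d) transitive

  movedByOne : ∀ x → Moved σ₀ x ⊎ Moved σ₁ x
  movedByOne x with Moved? σ₀ x
  ... | yes moved₀ = inj₁ moved₀
  ... | no ¬moved₀ = inj₂ (noCommon x (decidable-stable (Fixed? σ₀ x) ¬moved₀))

  both : ℕ
  both = count (λ x → Moved σ₀ x × Moved σ₁ x) (λ x → Moved? σ₀ x ×-dec Moved? σ₁ x)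

  both+d≡e₀+e₁ : both + d ≡ e₀ + e₁
  both+d≡e₀+e₁ = begin
    both + d                                          ≡⟨ cong (both +_) (sym (length-tabulate id)) ⟩
    both + length (allFin d)                          ≡⟨ count-covering (Moved? σ₀) (Moved? σ₁) movedByOne (allFin d) ⟩
    count (Moved σ₀) (Moved? σ₀) + count (Moved σ₁) (Moved? σ₁) ≡⟨ cong₂ _+_ (singleCycle-moved cycle₀) (singleCycle-moved cycle₁) ⟩
    e₀ + e₁                                           ∎
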